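{- Let $q$ be a prime power, let $A$ be a Singer cycle of $\mathrm{GL}(2,q)$, let $G_q(A)=\{(b,B): B\in\langle A\rangle,\ b\in\mathbb{F}_q^2\}$ act on the set $\Omega$ of lines of $\mathbb{F}_q^2$, and let $M_q=\bigcap_{\ell\in\mathrm{PG}(1,q)}\mathrm{Stab}(G_q(A),\Omega_\ell)$, where $\Omega_\ell=\{\ell+b:b\in\mathbb{F}_q^2\}$. Then $\mathrm{Fix}(G_q(A))=M_q$.
   Context: A Singer cycle of $\mathrm{GL}(2,q)$ is an element of order $q^2-1$. $(b,B)$ denotes the affine map $v\mapsto Bv+b$, with multiplication $(a,A)(b,B)=(a+Ab,AB)$. Lines of $\mathbb{F}_q^2$ are the sets $\{u+tv:t\in\mathbb{F}_q\}$ with $v\neq0$. $\mathrm{PG}(1,q)$ is the set of $1$-dimensional subspaces of $\mathbb{F}_q^2$; $\mathrm{Stab}(G_q(A),S)$ is the setwise stabilizer of $S\subseteq\Omega$. For a permutation group $G$ on $\Omega$, $\mathrm{Fix}(G)$ is the subgroup generated by all point-stabilizers $G_\omega$, $\omega\in\Omega$. -}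

module Defs where

open import Level using (Level; _⊔_; suc)
open import Data.Nat as ℕ using (ℕ; zero)
import Data.Nat.Primality as P
open import Data.Fin using (Fin)
open import Data.Product using (Σ; ∃; _×_; _,_)
open import Relation.Nullary using (¬_)
open import Relation.Binary.PropositionalEquality using (_≡_)
open import Algebra.Bundles using (CommutativeRing)

IsPrimePower : ℕ → Set
IsPrimePower q = Σ ℕ λ p → Σ ℕ λ k → P.Prime p × q ≡ p ℕ.^ ℕ.suc k

record Field (c ℓ : Level) : Set (suc (c ⊔ ℓ)) where
  field
    commRing : CommutativeRing c ℓ
  open CommutativeRing commRing public hiding (ring)
  field
    1≉0 : ¬ (1# ≈ 0#)
    inverse : ∀ x → ¬ (x ≈ 0#) → Σ Carrier λ y → x * y ≈ 1#

HasSize : ∀ {c ℓ} → Field c ℓ → ℕ → Set (c ⊔ ℓ)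
HasSize F q = Σ (Fin q → Carrier) λ e →
                 (∀ i j → e i ≈ e j → i ≡ j) × (∀ x → Σ (Fin q) λ i → e i ≈ x)
  where open Field F

module Geometry {c ℓ} (F : Field c ℓ) where
  open Field F

  record V : Set c where
    constructor vec
    field x y : Carrier
  open V public

  record M : Set c where
    constructor mat
    field m11 m12 m21 m22 : Carrier
  open M public

  _≈V_ : V → V → Set ℓ
  u ≈V v = (x u ≈ x v) × (y u ≈ y v)

  _≈M_ : M → M → Set ℓ
  A ≈M B = (m11 A ≈ m11 B) × (m12 A ≈ m12 B) × (m21 A ≈ m21 B) × (m22 A ≈ m22 B)

  0V : V
  0V = vec 0# 0#

  _+V_ : V → V → V
  u +V v = vec (x u + x v) (y u + y v)

  _·V_ : Carrier → V → V
  t ·V v = vec (t * x v) (t * y v)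

  _⊙_ : M → V → V
  A ⊙ v = vec (m11 A * x v + m12 A * y v) (m21 A * x v + m22 A * y v)

  _⊗_ : M → M → M
  A ⊗ B = mat (m11 A * m11 B + m12 A * m21 B) (m11 A * m12 B + m12 A * m22 B)
              (m21 A * m11 B + m22 A * m21 B) (m21 A * m12 B + m22 A * m22 B)

  I : M
  I = mat 1# 0# 0# 1#

  _^M_ : M → ℕ → M
  A ^M zero = I
  A ^M ℕ.suc n = A ⊗ (A ^M n)

  HasOrder : M → ℕ → Set ℓ
  HasOrder A n = ((A ^M n) ≈M I) × (∀ k → 0 ℕ.< k → k ℕ.< n → ¬ ((A ^M k) ≈M I))

  Singer : ℕ → M → Set ℓ
  Singer q A = HasOrder A (q ℕ.* q ℕ.∸ 1)

  -- affine maps (b , B) : v ↦ B v + b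
  Aff : Set c
  Aff = V × M

  _≈A_ : Aff → Aff → Set ℓ
  (b₁ , B₁) ≈A (b₂ , B₂) = (b₁ ≈V b₂) × (B₁ ≈M B₂)

  _∘A_ : Aff → Aff → Aff
  (a₁ , A₁) ∘A (b₁ , B₁) = (a₁ +V (A₁ ⊙ b₁)) , (A₁ ⊗ B₁)

  idA : Aff
  idA = 0V , I

  -- lines {u + t v : t ∈ F} with v ≠ 0, represented by the pair (u , v)
  LineRep : Set c
  LineRep = V × V

  IsLine : LineRep → Set ℓ
  IsLine (u , v) = ¬ (v ≈V 0V)

  OnLine : V → LineRep → Set (c ⊔ ℓ)
  OnLine p (u , v) = Σ Carrier λ t → p ≈V (u +V (t ·V v))

  _≈L_ : LineRep → LineRep → Set (c ⊔ ℓ)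
  L₁ ≈L L₂ = ∀ p → (OnLine p L₁ → OnLine p L₂) × (OnLine p L₂ → OnLine p L₁)

  act : Aff → LineRep → LineRep
  act (b₀ , B) (u , v) = ((B ⊙ u) +V b₀) , (B ⊙ v)

  module WithA (A : M) where

    InG : Aff → Set ℓ
    InG (b₀ , B) = Σ ℕ λ k → B ≈M (A ^M k)

    InStab : LineRep → Aff → Set (c ⊔ ℓ)
    InStab ω g = InG g × (act g ω ≈L ω)

    -- Fix(G): subgroup of G generated by all point stabilizers G_ω, ω ∈ Ω
    data InFix : Aff → Set (c ⊔ ℓ) where
      gen  : ∀ {g} ω → IsLine ω → InStab ω g → InFix g
      one  : InFix idA
      mul  : ∀ {g h} → InFix g → InFix h → InFix (g ∘A h)
      inv  : ∀ {g h} → InFix g → InG h → (h ∘A g) ≈A idA → InFix h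
      resp : ∀ {g h} → InFix g → g ≈A h → InFix h

    -- Ω_ℓ for ℓ = span(v): the lines {b + t v}, b ∈ F_q^2
    InOmega : V → LineRep → Set (c ⊔ ℓ)
    InOmega v L = Σ V λ b₀ → L ≈L (b₀ , v)

    StabOmega : V → Aff → Set (c ⊔ ℓ)
    StabOmega v g =
      (∀ L → IsLine L → InOmega v L → InOmega v (act g L)) ×
      (∀ L → IsLine L → InOmega v L →
         Σ LineRep λ L′ → IsLine L′ × InOmega v L′ × (act g L′ ≈L L))

    InMq : Aff → Set (c ⊔ ℓ)
    InMq g = InG g × (∀ v → ¬ (v ≈V 0V) → StabOmega v g)

module Submission where

-- A dilation is an affine map whose linear part is a nonzero scalar matrix s·I; it maps every
-- line to a parallel one, so it lies in M_q. Conversely, an element of M_q maps every direction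
-- to itself, so its linear part is scalar; and a dilation (b, s·I) of G_q(A) is the product of
-- two translations, each fixing a line in its own direction, and the homothety (0, s·I), which
-- fixes the lines through 0, so it lies in Fix(G_q(A)). Since dilations form a group, the
-- remaining point is that a point stabilizer consists of dilations: if (b, A^k) fixes a line with
-- direction v, then v and A v are eigenvectors of A^k for the same eigenvalue, and they are
-- independent because a Singer cycle has no eigenvector, so A^k is scalar. Finally, A v = μ v is
-- impossible: the powers of A lie in the q²-element span of I and A, and the q² - 1 distinct
-- powers together with 0 and the singular A - μ·I are too many (if A = μ·I the span has only
-- q elements).

open import Defs
open import Level using (Level; _⊔_)
open import Function using (_∘_)
open import Function.Bundles using (_⇔_; mk⇔)
open import Data.Empty using (⊥; ⊥-elim)
open import Data.Product using (Σ; ∃₂; _×_; _,_; proj₁; proj₂)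
open import Data.Maybe using (Maybe; just; nothing)
open import Data.Nat as ℕ using (ℕ; zero; suc)
import Data.Nat.Properties as ℕ
open import Data.Integer as ℤ using (ℤ; +_; -[1+_]; _⊖_)
import Data.Integer.Properties as ℤ
open import Data.Sign using (Sign)
open import Data.Fin as Fin using (Fin)
import Data.Fin.Properties as FP
open import Relation.Nullary using (¬_; yes; no; _×-dec_)
open import Relation.Binary.Bundles using (Setoid)
open import Relation.Binary.Definitions using (Decidable)
open import Relation.Binary.PropositionalEquality as ≡ using (_≡_)
open import Algebra.Bundles using (CommutativeRing)
open import Algebra.Solver.Ring.AlmostCommutativeRing
  using (fromCommutativeRing; _-Raw-AlmostCommutative⟶_)

-- Algebra.Solver.Ring needs a coefficient ring whose equality it can decide while normalising;
-- ℤ, mapped into R, serves for every commutative ring.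
module IntegerCoefficientSolver {c ℓ} (R : CommutativeRing c ℓ) where
  open CommutativeRing R
  open import Algebra.Properties.Ring ring using (-‿distribˡ-*; -‿distribʳ-*)
  open import Algebra.Properties.AbelianGroup +-abelianGroup
    using (⁻¹-∙-comm; ⁻¹-involutive; ε⁻¹≈ε)
  open import Algebra.Properties.Semiring.Mult.TCOptimised semiring
    using (1+×; ×-homo-+; ×1-homo-*) renaming (_×_ to _·_)
  open import Relation.Binary.Reasoning.Setoid setoid

  ⟦_⟧ : ℤ → Carrier
  ⟦ + n ⟧      = n · 1#
  ⟦ -[1+ n ] ⟧ = - (suc n · 1#)

  private
    -‿+-distrib : ∀ x y → - (x + y) ≈ - x + - y
    -‿+-distrib x y = sym (⁻¹-∙-comm x y)

    +-cancel-shared : ∀ a x y → (a + x) - (a + y) ≈ x - y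
    +-cancel-shared a x y = begin
      (a + x) + - (a + y)    ≈⟨ +-congˡ (-‿+-distrib a y) ⟩
      (a + x) + (- a + - y)  ≈⟨ +-assoc a x (- a + - y) ⟩
      a + (x + (- a + - y))  ≈⟨ +-congˡ (sym (+-assoc x (- a) (- y))) ⟩
      a + ((x + - a) + - y)  ≈⟨ +-congˡ (+-congʳ (+-comm x (- a))) ⟩
      a + ((- a + x) + - y)  ≈⟨ +-congˡ (+-assoc (- a) x (- y)) ⟩
      a + (- a + (x + - y))  ≈⟨ sym (+-assoc a (- a) (x + - y)) ⟩
      (a + - a) + (x + - y)  ≈⟨ +-congʳ (-‿inverseʳ a) ⟩
      0# + (x + - y)         ≈⟨ +-identityˡ _ ⟩
      x - y                  ∎

    ⊖-homo : ∀ m n → ⟦ m ⊖ n ⟧ ≈ m · 1# - n · 1#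
    ⊖-homo m zero rewrite ℤ.⊖-≥ {m} {0} ℕ.z≤n =
      sym (trans (+-congˡ ε⁻¹≈ε) (+-identityʳ _))
    ⊖-homo zero (suc n) rewrite ℤ.⊖-≤ {0} {suc n} ℕ.z≤n = sym (+-identityˡ _)
    ⊖-homo (suc m) (suc n) rewrite ℤ.[1+m]⊖[1+n]≡m⊖n m n = begin
      ⟦ m ⊖ n ⟧                      ≈⟨ ⊖-homo m n ⟩
      m · 1# - n · 1#                ≈⟨ +-cancel-shared 1# (m · 1#) (n · 1#) ⟨
      (1# + m · 1#) - (1# + n · 1#)  ≈⟨ +-cong (1+× m 1#) (-‿cong (1+× n 1#)) ⟨
      suc m · 1# - suc n · 1#        ∎

    +◃-homo : ∀ n → ⟦ Sign.+ ℤ.◃ n ⟧ ≈ n · 1#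
    +◃-homo zero    = refl
    +◃-homo (suc n) = refl

    -◃-homo : ∀ n → ⟦ Sign.- ℤ.◃ n ⟧ ≈ - (n · 1#)
    -◃-homo zero    = sym ε⁻¹≈ε
    -◃-homo (suc n) = refl

    +-homo : ∀ i j → ⟦ i ℤ.+ j ⟧ ≈ ⟦ i ⟧ + ⟦ j ⟧
    +-homo (+ m)    (+ n)    = ×-homo-+ 1# m n
    +-homo (+ m)    -[1+ n ] = ⊖-homo m (suc n)
    +-homo -[1+ m ] (+ n)    = trans (⊖-homo n (suc m)) (+-comm _ _)
    +-homo -[1+ m ] -[1+ n ] = begin
      - (suc (suc (m ℕ.+ n)) · 1#)     ≡⟨ ≡.cong (λ k → - (suc k · 1#)) (ℕ.+-suc m n) ⟨
      - ((suc m ℕ.+ suc n) · 1#)       ≈⟨ -‿cong (×-homo-+ 1# (suc m) (suc n)) ⟩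
      - (suc m · 1# + suc n · 1#)      ≈⟨ -‿+-distrib _ _ ⟩
      - (suc m · 1#) + - (suc n · 1#)  ∎

    *-homo : ∀ i j → ⟦ i ℤ.* j ⟧ ≈ ⟦ i ⟧ * ⟦ j ⟧
    *-homo (+ m) (+ n) = trans (+◃-homo (m ℕ.* n)) (×1-homo-* m n)
    *-homo (+ m) -[1+ n ] = begin
      ⟦ Sign.- ℤ.◃ (m ℕ.* suc n) ⟧  ≈⟨ -◃-homo (m ℕ.* suc n) ⟩
      - ((m ℕ.* suc n) · 1#)        ≈⟨ -‿cong (×1-homo-* m (suc n)) ⟩
      - (m · 1# * suc n · 1#)       ≈⟨ -‿distribʳ-* _ _ ⟩
      m · 1# * - (suc n · 1#)       ∎
    *-homo -[1+ m ] (+ n) = begin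
      ⟦ Sign.- ℤ.◃ (suc m ℕ.* n) ⟧  ≈⟨ -◃-homo (suc m ℕ.* n) ⟩
      - ((suc m ℕ.* n) · 1#)        ≈⟨ -‿cong (×1-homo-* (suc m) n) ⟩
      - (suc m · 1# * n · 1#)       ≈⟨ -‿distribˡ-* _ _ ⟩
      - (suc m · 1#) * n · 1#       ∎
    *-homo -[1+ m ] -[1+ n ] = begin
      ⟦ Sign.+ ℤ.◃ (suc m ℕ.* suc n) ⟧  ≈⟨ +◃-homo (suc m ℕ.* suc n) ⟩
      (suc m ℕ.* suc n) · 1#            ≈⟨ ×1-homo-* (suc m) (suc n) ⟩
      a * b                             ≈⟨ *-congʳ (⁻¹-involutive a) ⟨
      - - a * b                         ≈⟨ -‿distribˡ-* (- a) b ⟨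
      - (- a * b)                       ≈⟨ -‿distribʳ-* (- a) b ⟩
      - a * - b                         ∎
      where a = suc m · 1#; b = suc n · 1#

    -‿homo : ∀ i → ⟦ ℤ.- i ⟧ ≈ - ⟦ i ⟧
    -‿homo (+ zero)  = sym ε⁻¹≈ε
    -‿homo (+ suc n) = refl
    -‿homo -[1+ n ]  = sym (⁻¹-involutive _)

  ℤ⟶R : ℤ.+-*-rawRing -Raw-AlmostCommutative⟶ fromCommutativeRing R
  ℤ⟶R = record
    { ⟦_⟧    = ⟦_⟧
    ; +-homo = +-homo
    ; *-homo = *-homo
    ; -‿homo = -‿homo
    ; 0-homo = refl
    ; 1-homo = refl
    }

  ⟦⟧-≟ : ∀ i j → Maybe (⟦ i ⟧ ≈ ⟦ j ⟧)
  ⟦⟧-≟ i j with i ℤ.≟ j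
  ... | yes ≡.refl = just refl
  ... | no _       = nothing

  open import Algebra.Solver.Ring ℤ.+-*-rawRing (fromCommutativeRing R) ℤ⟶R ⟦⟧-≟ public
    using (solve; _:=_; con; _:+_; _:*_; _:-_; :-_)

module AffinePlane {c ℓ} (F : Field c ℓ) where
  open Field F
  open Geometry F
  open IntegerCoefficientSolver commRing
  open import Algebra.Properties.AbelianGroup +-abelianGroup
    using (x∙y⁻¹≈ε⇒x≈y; x≈y⇒x∙y⁻¹≈ε)
  open import Relation.Binary.Reasoning.Setoid setoid

  x-y≈0⇒x≈y : ∀ {x y} → x - y ≈ 0# → x ≈ y
  x-y≈0⇒x≈y = x∙y⁻¹≈ε⇒x≈y _ _

  x≈y⇒x-y≈0 : ∀ {x y} → x ≈ y → x - y ≈ 0#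
  x≈y⇒x-y≈0 = x≈y⇒x∙y⁻¹≈ε

  *-cancelˡ : ∀ {a x y} → ¬ (a ≈ 0#) → a * x ≈ a * y → x ≈ y
  *-cancelˡ {a} {x} {y} a≉0 ax≈ay with inverse a a≉0
  ... | a⁻¹ , aa⁻¹≈1 = begin
    x              ≈⟨ unit x ⟨
    a⁻¹ * (a * x)  ≈⟨ *-congˡ ax≈ay ⟩
    a⁻¹ * (a * y)  ≈⟨ unit y ⟩
    y              ∎
    where
    unit : ∀ z → a⁻¹ * (a * z) ≈ z
    unit z = trans (solve 3 (λ a a⁻¹ z → a⁻¹ :* (a :* z) := (a :* a⁻¹) :* z) refl a a⁻¹ z)
                   (trans (*-congʳ aa⁻¹≈1) (*-identityˡ z))

  no-zero-divisors : ∀ {a b} → a * b ≈ 0# → ¬ (a ≈ 0#) → b ≈ 0#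
  no-zero-divisors {a} ab≈0 a≉0 = *-cancelˡ a≉0 (trans ab≈0 (sym (zeroʳ a)))

  *-nonzero : ∀ {a b} → ¬ (a ≈ 0#) → ¬ (b ≈ 0#) → ¬ (a * b ≈ 0#)
  *-nonzero a≉0 b≉0 ab≈0 = b≉0 (no-zero-divisors ab≈0 a≉0)

  inverse-nonzero : ∀ {a b} → a * b ≈ 1# → ¬ (b ≈ 0#)
  inverse-nonzero {a} ab≈1 b≈0 = 1≉0 (trans (sym ab≈1) (trans (*-congˡ b≈0) (zeroʳ a)))

  proportion : ∀ {a c} → ¬ (a ≈ 0#) → Σ Carrier λ μ → ∀ {b d} → a * d ≈ b * c → d ≈ μ * b
  proportion {a} {c} a≉0 with inverse a a≉0
  ... | a⁻¹ , aa⁻¹≈1 = c * a⁻¹ , λ {b} {d} ad≈bc → begin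
    d              ≈⟨ *-identityˡ d ⟨
    1# * d         ≈⟨ *-congʳ aa⁻¹≈1 ⟨
    (a * a⁻¹) * d  ≈⟨ solve 3 (λ a a⁻¹ d → (a :* a⁻¹) :* d := a⁻¹ :* (a :* d)) refl a a⁻¹ d ⟩
    a⁻¹ * (a * d)  ≈⟨ *-congˡ ad≈bc ⟩
    a⁻¹ * (b * c)  ≈⟨ solve 3 (λ a⁻¹ b c → a⁻¹ :* (b :* c) := (c :* a⁻¹) :* b) refl a⁻¹ b c ⟩
    (c * a⁻¹) * b  ∎

  ≈V-refl : ∀ {u} → u ≈V u
  ≈V-refl = refl , refl

  ≈V-sym : ∀ {u v} → u ≈V v → v ≈V u
  ≈V-sym (p , q) = sym p , sym q

  ≈V-trans : ∀ {u v w} → u ≈V v → v ≈V w → u ≈V w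
  ≈V-trans (p , q) (p′ , q′) = trans p p′ , trans q q′

  ≈M-refl : ∀ {X} → X ≈M X
  ≈M-refl = refl , refl , refl , refl

  ≈M-sym : ∀ {X Y} → X ≈M Y → Y ≈M X
  ≈M-sym (a , b , d , e) = sym a , sym b , sym d , sym e

  ≈M-trans : ∀ {X Y Z} → X ≈M Y → Y ≈M Z → X ≈M Z
  ≈M-trans (a , b , d , e) (a′ , b′ , d′ , e′) = trans a a′ , trans b b′ , trans d d′ , trans e e′

  ≈M-setoid : Setoid c ℓ
  ≈M-setoid = record
    { Carrier       = M
    ; _≈_           = _≈M_
    ; isEquivalence = record { refl = ≈M-refl ; sym = ≈M-sym ; trans = ≈M-trans }
    }

  +V-cong : ∀ {u u′ v v′} → u ≈V u′ → v ≈V v′ → (u +V v) ≈V (u′ +V v′)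
  +V-cong (p , q) (p′ , q′) = +-cong p p′ , +-cong q q′

  ·V-cong : ∀ {s t u v} → s ≈ t → u ≈V v → (s ·V u) ≈V (t ·V v)
  ·V-cong s≈t (p , q) = *-cong s≈t p , *-cong s≈t q

  ·V-zero : ∀ {t} → t ≈ 0# → ∀ v → (t ·V v) ≈V 0V
  ·V-zero t≈0 v = trans (*-congʳ t≈0) (zeroˡ (x v)) , trans (*-congʳ t≈0) (zeroˡ (y v))

  ⊗-cong : ∀ {X X′ Y Y′} → X ≈M X′ → Y ≈M Y′ → (X ⊗ Y) ≈M (X′ ⊗ Y′)
  ⊗-cong (a , b , d , e) (a′ , b′ , d′ , e′) =
    +-cong (*-cong a a′) (*-cong b d′) , +-cong (*-cong a b′) (*-cong b e′) ,
    +-cong (*-cong d a′) (*-cong e d′) , +-cong (*-cong d b′) (*-cong e e′)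

  ⊙-cong : ∀ {X X′ u u′} → X ≈M X′ → u ≈V u′ → (X ⊙ u) ≈V (X′ ⊙ u′)
  ⊙-cong (a , b , d , e) (p , q) =
    +-cong (*-cong a p) (*-cong b q) , +-cong (*-cong d p) (*-cong e q)

  private
    row-assoc : ∀ a b a′ b′ d′ e′ g h →
      (a * a′ + b * d′) * g + (a * b′ + b * e′) * h ≈ a * (a′ * g + b′ * h) + b * (d′ * g + e′ * h)
    row-assoc = solve 8 (λ a b a′ b′ d′ e′ g h →
      (a :* a′ :+ b :* d′) :* g :+ (a :* b′ :+ b :* e′) :* h
        := a :* (a′ :* g :+ b′ :* h) :+ b :* (d′ :* g :+ e′ :* h)) refl

    row-identity : ∀ a b → 1# * a + 0# * b ≈ a
    row-identity = solve 2 (λ a b → con (+ 1) :* a :+ con (+ 0) :* b := a) refl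

  ⊗-assoc : ∀ X Y Z → ((X ⊗ Y) ⊗ Z) ≈M (X ⊗ (Y ⊗ Z))
  ⊗-assoc (mat a b d e) (mat a′ b′ d′ e′) (mat a″ b″ d″ e″) =
    row-assoc a b a′ b′ d′ e′ a″ d″ , row-assoc a b a′ b′ d′ e′ b″ e″ ,
    row-assoc d e a′ b′ d′ e′ a″ d″ , row-assoc d e a′ b′ d′ e′ b″ e″

  ⊗-⊙ : ∀ X Y v → ((X ⊗ Y) ⊙ v) ≈V (X ⊙ (Y ⊙ v))
  ⊗-⊙ (mat a b d e) (mat a′ b′ d′ e′) (vec v₁ v₂) =
    row-assoc a b a′ b′ d′ e′ v₁ v₂ , row-assoc d e a′ b′ d′ e′ v₁ v₂

  ⊗-identityˡ : ∀ X → (I ⊗ X) ≈M X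
  ⊗-identityˡ (mat a b d e) =
    row-identity a d , row-identity b e ,
    trans (+-comm _ _) (row-identity d a) , trans (+-comm _ _) (row-identity e b)

  ⊗-identityʳ : ∀ X → (X ⊗ I) ≈M X
  ⊗-identityʳ (mat a b d e) =
    row a b , trans (+-comm _ _) (row b a) , row d e , trans (+-comm _ _) (row e d)
    where
    row : ∀ a b → a * 1# + b * 0# ≈ a
    row a b = trans (+-cong (*-comm a 1#) (*-comm b 0#)) (row-identity a b)

  ⊙-identity : ∀ v → (I ⊙ v) ≈V v
  ⊙-identity (vec a b) = row-identity a b , trans (+-comm _ _) (row-identity b a)

  ⊙-zero : ∀ X → (X ⊙ 0V) ≈V 0V
  ⊙-zero (mat a b d e) = row a b , row d e
    where
    row : ∀ a b → a * 0# + b * 0# ≈ 0#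
    row a b = trans (+-cong (zeroʳ a) (zeroʳ b)) (+-identityʳ 0#)

  ⊙-+V-·V : ∀ X u t v → (X ⊙ (u +V (t ·V v))) ≈V ((X ⊙ u) +V (t ·V (X ⊙ v)))
  ⊙-+V-·V (mat a b d e) (vec u₁ u₂) t (vec v₁ v₂) = row a b , row d e
    where
    row : ∀ a b → a * (u₁ + t * v₁) + b * (u₂ + t * v₂) ≈ (a * u₁ + b * u₂) + t * (a * v₁ + b * v₂)
    row = solve 7 (λ u₁ u₂ t v₁ v₂ a b →
      a :* (u₁ :+ t :* v₁) :+ b :* (u₂ :+ t :* v₂) := (a :* u₁ :+ b :* u₂) :+ t :* (a :* v₁ :+ b :* v₂))
      refl u₁ u₂ t v₁ v₂

  ⊙-·V : ∀ X t v → (X ⊙ (t ·V v)) ≈V (t ·V (X ⊙ v))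
  ⊙-·V (mat a b d e) t (vec v₁ v₂) = row a b , row d e
    where
    row : ∀ a b → a * (t * v₁) + b * (t * v₂) ≈ t * (a * v₁ + b * v₂)
    row = solve 5 (λ t v₁ v₂ a b → a :* (t :* v₁) :+ b :* (t :* v₂) := t :* (a :* v₁ :+ b :* v₂))
      refl t v₁ v₂

  scalar : Carrier → M
  scalar t = mat t 0# 0# t

  scalar-⊙ : ∀ t v → (scalar t ⊙ v) ≈V (t ·V v)
  scalar-⊙ t (vec a b) =
    trans (+-congˡ (zeroˡ b)) (+-identityʳ _) , trans (+-congʳ (zeroˡ a)) (+-identityˡ _)

  scalar-⊗ : ∀ s t → (scalar s ⊗ scalar t) ≈M scalar (s * t)
  scalar-⊗ s t = diagonal , off-diagonal , trans (+-comm _ _) off-diagonal , trans (+-comm _ _) diagonal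
    where
    diagonal : s * t + 0# * 0# ≈ s * t
    diagonal = trans (+-congˡ (zeroˡ 0#)) (+-identityʳ _)
    off-diagonal : s * 0# + 0# * t ≈ 0#
    off-diagonal = trans (+-cong (zeroʳ s) (zeroˡ t)) (+-identityʳ 0#)

  det : V → V → Carrier
  det u w = x u * y w - y u * x w

  -- Each row (p, r) of B - l·I kills v and w, and p · det v w, r · det v w are combinations of these two products.
  common-eigenvectors⇒scalar : ∀ B {v w l} → (B ⊙ v) ≈V (l ·V v) → (B ⊙ w) ≈V (l ·V w) →
                               ¬ (det v w ≈ 0#) → B ≈M scalar l
  common-eigenvectors⇒scalar (mat b₁₁ b₁₂ b₂₁ b₂₂) {vec v₁ v₂} {vec w₁ w₂} {l}
    (Bv≈₁ , Bv≈₂) (Bw≈₁ , Bw≈₂) det≉0 =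
    x-y≈0⇒x≈y (proj₁ (row₁ Bv≈₁ Bw≈₁)) , proj₂ (row₁ Bv≈₁ Bw≈₁) ,
    proj₁ (row₂ Bv≈₂ Bw≈₂) , x-y≈0⇒x≈y (proj₂ (row₂ Bv≈₂ Bw≈₂))
    where
    kernel-row : ∀ p r → p * v₁ + r * v₂ ≈ 0# → p * w₁ + r * w₂ ≈ 0# → (p ≈ 0#) × (r ≈ 0#)
    kernel-row p r pv≈0 pw≈0 =
      no-zero-divisors (trans (*-comm _ _) p·det) det≉0 , no-zero-divisors (trans (*-comm _ _) r·det) det≉0
      where
      vanish : ∀ α β γ δ → α ≈ 0# → β ≈ 0# → α * γ - β * δ ≈ 0#
      vanish α β γ δ α≈0 β≈0 = trans (+-cong (trans (*-congʳ α≈0) (zeroˡ γ)) (-‿cong (trans (*-congʳ β≈0) (zeroˡ δ))))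
                                     (solve 0 (con (+ 0) :- con (+ 0) := con (+ 0)) refl)
      p·det : p * det (vec v₁ v₂) (vec w₁ w₂) ≈ 0#
      p·det = trans (solve 6 (λ p r v₁ v₂ w₁ w₂ → p :* (v₁ :* w₂ :- v₂ :* w₁)
                                 := (p :* v₁ :+ r :* v₂) :* w₂ :- (p :* w₁ :+ r :* w₂) :* v₂) refl p r v₁ v₂ w₁ w₂)
                    (vanish _ _ w₂ v₂ pv≈0 pw≈0)
      r·det : r * det (vec v₁ v₂) (vec w₁ w₂) ≈ 0#
      r·det = trans (solve 6 (λ p r v₁ v₂ w₁ w₂ → r :* (v₁ :* w₂ :- v₂ :* w₁)
                                 := (p :* w₁ :+ r :* w₂) :* v₁ :- (p :* v₁ :+ r :* v₂) :* w₁) refl p r v₁ v₂ w₁ w₂)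
                    (vanish _ _ v₁ w₁ pw≈0 pv≈0)
    row₁ : b₁₁ * v₁ + b₁₂ * v₂ ≈ l * v₁ → b₁₁ * w₁ + b₁₂ * w₂ ≈ l * w₁ → (b₁₁ - l ≈ 0#) × (b₁₂ ≈ 0#)
    row₁ hv hw = kernel-row (b₁₁ - l) b₁₂ (shift v₁ v₂ hv) (shift w₁ w₂ hw)
      where
      shift : ∀ u₁ u₂ → b₁₁ * u₁ + b₁₂ * u₂ ≈ l * u₁ → (b₁₁ - l) * u₁ + b₁₂ * u₂ ≈ 0#
      shift u₁ u₂ h = trans (solve 5 (λ a b u₁ u₂ l → (a :- l) :* u₁ :+ b :* u₂ := (a :* u₁ :+ b :* u₂) :- l :* u₁)
                                      refl b₁₁ b₁₂ u₁ u₂ l)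
                            (x≈y⇒x-y≈0 h)
    row₂ : b₂₁ * v₁ + b₂₂ * v₂ ≈ l * v₂ → b₂₁ * w₁ + b₂₂ * w₂ ≈ l * w₂ → (b₂₁ ≈ 0#) × (b₂₂ - l ≈ 0#)
    row₂ hv hw = kernel-row b₂₁ (b₂₂ - l) (shift v₁ v₂ hv) (shift w₁ w₂ hw)
      where
      shift : ∀ u₁ u₂ → b₂₁ * u₁ + b₂₂ * u₂ ≈ l * u₂ → b₂₁ * u₁ + (b₂₂ - l) * u₂ ≈ 0#
      shift u₁ u₂ h = trans (solve 5 (λ a b u₁ u₂ l → a :* u₁ :+ (b :- l) :* u₂ := (a :* u₁ :+ b :* u₂) :- l :* u₂)
                                      refl b₂₁ b₂₂ u₁ u₂ l)
                            (x≈y⇒x-y≈0 h)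

  det≈0⇒parallel : Decidable _≈_ → ∀ {v w} → ¬ (v ≈V 0V) → det v w ≈ 0# → Σ Carrier λ μ → w ≈V (μ ·V v)
  det≈0⇒parallel _≟_ {vec v₁ v₂} {vec w₁ w₂} v≉0 det≈0 with v₁ ≟ 0# | v₂ ≟ 0#
  ... | no v₁≉0 | _ with proportion v₁≉0
  ...   | μ , prop = μ , prop refl , prop (x-y≈0⇒x≈y det≈0)
  det≈0⇒parallel _≟_ {vec v₁ v₂} {vec w₁ w₂} v≉0 det≈0 | yes _ | no v₂≉0 with proportion v₂≉0
  ...   | μ , prop = μ , prop (sym (x-y≈0⇒x≈y det≈0)) , prop refl
  det≈0⇒parallel _≟_ v≉0 det≈0 | yes v₁≈0 | yes v₂≈0 = ⊥-elim (v≉0 (v₁≈0 , v₂≈0))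

  ≈L-refl : ∀ {L} → L ≈L L
  ≈L-refl p = (λ h → h) , (λ h → h)

  ≈L-sym : ∀ {L L′} → L ≈L L′ → L′ ≈L L
  ≈L-sym L≈L′ p = proj₂ (L≈L′ p) , proj₁ (L≈L′ p)

  ≈L-trans : ∀ {L L′ L″} → L ≈L L′ → L′ ≈L L″ → L ≈L L″
  ≈L-trans L≈L′ L′≈L″ p =
    (λ h → proj₁ (L′≈L″ p) (proj₁ (L≈L′ p) h)) , (λ h → proj₂ (L≈L′ p) (proj₂ (L′≈L″ p) h))

  line-cong : ∀ {u u′ v v′} → u ≈V u′ → v ≈V v′ → (u , v) ≈L (u′ , v′)
  line-cong u≈u′ v≈v′ p =
    (λ { (t , h) → t , ≈V-trans h (+V-cong u≈u′ (·V-cong refl v≈v′)) }) ,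
    (λ { (t , h) → t , ≈V-trans h (+V-cong (≈V-sym u≈u′) (·V-cong refl (≈V-sym v≈v′))) })

  line-rescale : ∀ {u w v s} → w ≈V (s ·V v) → ¬ (s ≈ 0#) → (u , w) ≈L (u , v)
  line-rescale {u} {w} {v} {s} w≈sv s≉0 p with inverse s s≉0
  ... | s⁻¹ , ss⁻¹≈1 =
    (λ { (t , h) → t * s , ≈V-trans h (+V-cong ≈V-refl (≈V-trans (·V-cong refl w≈sv) (rescale t s))) }) ,
    (λ { (t , h) → t * s⁻¹ , ≈V-trans h (+V-cong ≈V-refl (≈V-sym (unscale t))) })
    where
    rescale : ∀ t s → (t ·V (s ·V v)) ≈V ((t * s) ·V v)
    rescale t s = sym (*-assoc t s (x v)) , sym (*-assoc t s (y v))
    unscale : ∀ t → ((t * s⁻¹) ·V w) ≈V (t ·V v)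
    unscale t = ≈V-trans (·V-cong refl w≈sv)
      (≈V-trans (rescale (t * s⁻¹) s) (·V-cong cancel ≈V-refl))
      where
      cancel : t * s⁻¹ * s ≈ t
      cancel = trans (solve 3 (λ t s s⁻¹ → t :* s⁻¹ :* s := t :* (s :* s⁻¹)) refl t s s⁻¹)
                     (trans (*-congˡ ss⁻¹≈1) (*-identityʳ t))

  line-translate : ∀ {u u′ v s} → u ≈V (u′ +V (s ·V v)) → (u , v) ≈L (u′ , v)
  line-translate {vec u₁ u₂} {vec u′₁ u′₂} {vec v₁ v₂} {s} (h₁ , h₂) p =
    (λ { (t , h) → s + t , ≈V-trans h (forth u₁ u′₁ v₁ t h₁ , forth u₂ u′₂ v₂ t h₂) }) ,
    (λ { (t , h) → t - s , ≈V-trans h (back u₁ u′₁ v₁ t h₁ , back u₂ u′₂ v₂ t h₂) })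
    where
    forth : ∀ a a′ b t → a ≈ a′ + s * b → a + t * b ≈ a′ + (s + t) * b
    forth a a′ b t a≈ = trans (+-congʳ a≈)
      (solve 4 (λ a′ s b t → (a′ :+ s :* b) :+ t :* b := a′ :+ (s :+ t) :* b) refl a′ s b t)
    back : ∀ a a′ b t → a ≈ a′ + s * b → a′ + t * b ≈ a + (t - s) * b
    back a a′ b t a≈ = sym (trans (+-congʳ a≈)
      (solve 4 (λ a′ s b t → (a′ :+ s :* b) :+ (t :- s) :* b := a′ :+ t :* b) refl a′ s b t))

  -- The points of parameters 0 and 1 on the first line have parameters t₀, t₁ on the second.
  direction-parallel : ∀ {u w u′ v} → (u , w) ≈L (u′ , v) → Σ Carrier λ s → w ≈V (s ·V v)
  direction-parallel {vec a₁ a₂} {vec w₁ w₂} {vec b₁ b₂} {vec v₁ v₂} L≈L′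
    with proj₁ (L≈L′ (vec a₁ a₂ +V (0# ·V vec w₁ w₂))) (0# , ≈V-refl)
       | proj₁ (L≈L′ (vec a₁ a₂ +V (1# ·V vec w₁ w₂))) (1# , ≈V-refl)
  ... | t₀ , (p₀ , q₀) | t₁ , (p₁ , q₁) =
    t₁ - t₀ , difference a₁ w₁ b₁ v₁ p₀ p₁ , difference a₂ w₂ b₂ v₂ q₀ q₁
    where
    difference : ∀ a w b v → a + 0# * w ≈ b + t₀ * v → a + 1# * w ≈ b + t₁ * v → w ≈ (t₁ - t₀) * v
    difference a w b v h₀ h₁ = begin
      w                            ≈⟨ solve 2 (λ a w → w := (a :+ con (+ 1) :* w) :- (a :+ con (+ 0) :* w)) refl a w ⟩
      (a + 1# * w) - (a + 0# * w)  ≈⟨ +-cong h₁ (-‿cong h₀) ⟩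
      (b + t₁ * v) - (b + t₀ * v)  ≈⟨ solve 4 (λ b v t₀ t₁ → (b :+ t₁ :* v) :- (b :+ t₀ :* v) := (t₁ :- t₀) :* v) refl b v t₀ t₁ ⟩
      (t₁ - t₀) * v                ∎

  act-point : ∀ b X u t v → (((X ⊙ u) +V b) +V (t ·V (X ⊙ v))) ≈V ((X ⊙ (u +V (t ·V v))) +V b)
  act-point b X u t v = ≈V-trans (swap _ _ _ , swap _ _ _) (+V-cong (≈V-sym (⊙-+V-·V X u t v)) ≈V-refl)
    where
    swap : ∀ α β γ → (α + β) + γ ≈ (α + γ) + β
    swap = solve 3 (λ α β γ → (α :+ β) :+ γ := (α :+ γ) :+ β) refl

  act-⊆ : ∀ g {L L′} → (∀ p → OnLine p L → OnLine p L′) → ∀ p → OnLine p (act g L) → OnLine p (act g L′)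
  act-⊆ (b , X) {u , v} {u′ , v′} L⊆L′ p (t , h) with L⊆L′ (u +V (t ·V v)) (t , ≈V-refl)
  ... | s , h′ = s , ≈V-trans h (≈V-trans (act-point b X u t v)
                       (≈V-trans (+V-cong (⊙-cong ≈M-refl h′) ≈V-refl) (≈V-sym (act-point b X u′ s v′))))

  act-resp-≈L : ∀ g {L L′} → L ≈L L′ → act g L ≈L act g L′
  act-resp-≈L g L≈L′ p = act-⊆ g (λ p → proj₁ (L≈L′ p)) p , act-⊆ g (λ p → proj₂ (L≈L′ p)) p

  record IsDilation (g : Aff) : Set (c ⊔ ℓ) where
    constructor dilation
    field
      factor        : Carrier
      factor≉0      : ¬ (factor ≈ 0#)
      linear≈scalar : proj₂ g ≈M scalar factor

  dilation-resp : ∀ {g h} → g ≈A h → IsDilation g → IsDilation h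
  dilation-resp (_ , B≈C) (dilation s s≉0 B≈s) = dilation s s≉0 (≈M-trans (≈M-sym B≈C) B≈s)

  dilation-∘A : ∀ {g h} → IsDilation g → IsDilation h → IsDilation (g ∘A h)
  dilation-∘A (dilation s s≉0 B≈s) (dilation t t≉0 C≈t) =
    dilation (s * t) (*-nonzero s≉0 t≉0) (≈M-trans (⊗-cong B≈s C≈t) (scalar-⊗ s t))

  dilation-inverse : ∀ {g h} → (h ∘A g) ≈A idA → IsDilation g → IsDilation h
  dilation-inverse {_ , _} {_ , mat c₁₁ c₁₂ c₂₁ c₂₂} (_ , CB≈I) (dilation s s≉0 B≈s) with inverse s s≉0
  ... | s⁻¹ , ss⁻¹≈1 =
    dilation s⁻¹ (inverse-nonzero ss⁻¹≈1)
      (trans (solve-row c₁₁ c₁₂ (proj₁ Cs≈I)) (*-identityˡ s⁻¹) ,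
       trans (solve-row c₁₂ c₁₁ (trans (+-comm _ _) (proj₁ (proj₂ Cs≈I)))) (zeroˡ s⁻¹) ,
       trans (solve-row c₂₁ c₂₂ (proj₁ (proj₂ (proj₂ Cs≈I)))) (zeroˡ s⁻¹) ,
       trans (solve-row c₂₂ c₂₁ (trans (+-comm _ _) (proj₂ (proj₂ (proj₂ Cs≈I))))) (*-identityˡ s⁻¹))
    where
    Cs≈I : (mat c₁₁ c₁₂ c₂₁ c₂₂ ⊗ scalar s) ≈M I
    Cs≈I = ≈M-trans (⊗-cong ≈M-refl (≈M-sym B≈s)) CB≈I
    solve-row : ∀ a b {r} → a * s + b * 0# ≈ r → a ≈ r * s⁻¹
    solve-row a b {r} as≈r = begin
      a                       ≈⟨ *-identityʳ a ⟨
      a * 1#                  ≈⟨ *-congˡ ss⁻¹≈1 ⟨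
      a * (s * s⁻¹)           ≈⟨ solve 4 (λ a b s s⁻¹ → a :* (s :* s⁻¹) := (a :* s :+ b :* con (+ 0)) :* s⁻¹) refl a b s s⁻¹ ⟩
      (a * s + b * 0#) * s⁻¹  ≈⟨ *-congʳ as≈r ⟩
      r * s⁻¹                 ∎

  translation-fixes-parallel-lines : ∀ t u v → act (t ·V v , I) (u , v) ≈L (u , v)
  translation-fixes-parallel-lines t u v =
    ≈L-trans (line-cong (+V-cong (⊙-identity u) ≈V-refl) (⊙-identity v)) (line-translate ≈V-refl)

  homothety-fixes-lines-through-origin : ∀ {s} → ¬ (s ≈ 0#) → ∀ v → act (0V , scalar s) (0V , v) ≈L (0V , v)
  homothety-fixes-lines-through-origin {s} s≉0 v =
    ≈L-trans (line-cong (≈V-trans (+V-cong (⊙-zero (scalar s)) ≈V-refl) (+-identityʳ 0# , +-identityʳ 0#)) ≈V-refl)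
             (line-rescale (scalar-⊙ s v) s≉0)

  e₁ e₂ : V
  e₁ = vec 1# 0#
  e₂ = vec 0# 1#

  e₁≉0 : ¬ (e₁ ≈V 0V)
  e₁≉0 (1≈0 , _) = 1≉0 1≈0

  e₂≉0 : ¬ (e₂ ≈V 0V)
  e₂≉0 (_ , 1≈0) = 1≉0 1≈0

  translation-split : ∀ b → ((x b ·V e₁ , I) ∘A (y b ·V e₂ , I)) ≈A (b , I)
  translation-split (vec b₁ b₂) = (first b₁ b₂ , second b₁ b₂) , ⊗-identityˡ I
    where
    first : ∀ b₁ b₂ → b₁ * 1# + (1# * (b₂ * 0#) + 0# * (b₂ * 1#)) ≈ b₁
    first = solve 2 (λ b₁ b₂ → b₁ :* con (+ 1) :+ (con (+ 1) :* (b₂ :* con (+ 0)) :+ con (+ 0) :* (b₂ :* con (+ 1))) := b₁) refl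
    second : ∀ b₁ b₂ → b₁ * 0# + (0# * (b₂ * 0#) + 1# * (b₂ * 1#)) ≈ b₂
    second = solve 2 (λ b₁ b₂ → b₁ :* con (+ 0) :+ (con (+ 0) :* (b₂ :* con (+ 0)) :+ con (+ 1) :* (b₂ :* con (+ 1))) := b₂) refl

  dilation-split : ∀ b s → ((b , I) ∘A (0V , scalar s)) ≈A (b , scalar s)
  dilation-split b s = ≈V-trans (+V-cong ≈V-refl (⊙-zero I)) (+-identityʳ _ , +-identityʳ _) , ⊗-identityˡ (scalar s)

  all-eigenvectors⇒scalar : ∀ B → (∀ v → ¬ (v ≈V 0V) → Σ Carrier λ s → (B ⊙ v) ≈V (s ·V v)) → B ≈M scalar (m11 B)
  all-eigenvectors⇒scalar (mat b₁₁ b₁₂ b₂₁ b₂₂) eigen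
    with eigen e₁ e₁≉0 | eigen e₂ e₂≉0 | eigen (vec 1# 1#) (λ { (1≈0 , _) → 1≉0 1≈0 })
  ... | s₁ , (_ , b₂₁≈) | s₂ , (b₁₂≈ , _) | s₃ , (b₁₁+b₁₂≈ , b₂₁+b₂₂≈) =
    refl , b₁₂≈0 , b₂₁≈0 , b₂₂≈b₁₁
    where
    b₂₁≈0 : b₂₁ ≈ 0#
    b₂₁≈0 = trans (solve 2 (λ a b → a := a :* con (+ 1) :+ b :* con (+ 0)) refl b₂₁ b₂₂) (trans b₂₁≈ (zeroʳ s₁))
    b₁₂≈0 : b₁₂ ≈ 0#
    b₁₂≈0 = trans (solve 2 (λ a b → b := a :* con (+ 0) :+ b :* con (+ 1)) refl b₁₁ b₁₂) (trans b₁₂≈ (zeroʳ s₂))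
    row-sum : ∀ a b → a * 1# + b * 1# ≈ a + b
    row-sum a b = +-cong (*-identityʳ a) (*-identityʳ b)
    b₂₂≈b₁₁ : b₂₂ ≈ b₁₁
    b₂₂≈b₁₁ = begin
      b₂₂                  ≈⟨ +-identityˡ b₂₂ ⟨
      0# + b₂₂             ≈⟨ +-congʳ b₂₁≈0 ⟨
      b₂₁ + b₂₂            ≈⟨ trans (sym (row-sum b₂₁ b₂₂)) (trans b₂₁+b₂₂≈ (sym b₁₁+b₁₂≈)) ⟩
      b₁₁ * 1# + b₁₂ * 1#  ≈⟨ row-sum b₁₁ b₁₂ ⟩
      b₁₁ + b₁₂            ≈⟨ +-congˡ b₁₂≈0 ⟩
      b₁₁ + 0#             ≈⟨ +-identityʳ b₁₁ ⟩
      b₁₁                  ∎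

  module _ (A : M) where
    open WithA A

    translation∈Fix : ∀ b → InFix (b , I)
    translation∈Fix b = resp (mul (along e₁ e₁≉0 (x b)) (along e₂ e₂≉0 (y b))) (translation-split b)
      where
      along : ∀ v → ¬ (v ≈V 0V) → ∀ t → InFix (t ·V v , I)
      along v v≉0 t = gen (0V , v) v≉0 ((0 , ≈M-refl) , translation-fixes-parallel-lines t 0V v)

    dilation∈G⇒Fix : ∀ {g} → InG g → IsDilation g → InFix g
    dilation∈G⇒Fix {b , B} (k , B≈Aᵏ) (dilation s s≉0 B≈s) =
      resp (mul (translation∈Fix b) homothety∈Fix)
           (proj₁ (dilation-split b s) , ≈M-trans (proj₂ (dilation-split b s)) (≈M-sym B≈s))
      where
      homothety∈Fix : InFix (0V , scalar s)
      homothety∈Fix = gen (0V , e₁) e₁≉0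
        ((k , ≈M-trans (≈M-sym B≈s) B≈Aᵏ) , homothety-fixes-lines-through-origin s≉0 e₁)

    dilation⇒StabOmega : ∀ {g} → IsDilation g → ∀ v → ¬ (v ≈V 0V) → StabOmega v g
    dilation⇒StabOmega {b , B} (dilation s s≉0 B≈s) v v≉0 = image , preimage
      where
      Bv≈sv : (B ⊙ v) ≈V (s ·V v)
      Bv≈sv = ≈V-trans (⊙-cong B≈s ≈V-refl) (scalar-⊙ s v)

      image : ∀ L → IsLine L → InOmega v L → InOmega v (act (b , B) L)
      image L _ (u , L≈) = (B ⊙ u) +V b , ≈L-trans (act-resp-≈L (b , B) L≈) (line-rescale Bv≈sv s≉0)

      preimage : ∀ L → IsLine L → InOmega v L →
                 Σ LineRep λ L′ → IsLine L′ × InOmega v L′ × (act (b , B) L′ ≈L L)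
      preimage L _ (u , L≈) with inverse s s≉0
      ... | s⁻¹ , ss⁻¹≈1 = (u′ , v) , v≉0 , (u′ , ≈L-refl) ,
        ≈L-trans (line-cong Bu′+b≈u ≈V-refl) (≈L-trans (line-rescale Bv≈sv s≉0) (≈L-sym L≈))
        where
        u′ : V
        u′ = s⁻¹ ·V vec (x u - x b) (y u - y b)
        coordinate : ∀ a β → s * (s⁻¹ * (a - β)) + β ≈ a
        coordinate a β = begin
          s * (s⁻¹ * (a - β)) + β  ≈⟨ solve 4 (λ s s⁻¹ a β → s :* (s⁻¹ :* (a :- β)) :+ β := (s :* s⁻¹) :* (a :- β) :+ β) refl s s⁻¹ a β ⟩
          (s * s⁻¹) * (a - β) + β  ≈⟨ +-congʳ (*-congʳ ss⁻¹≈1) ⟩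
          1# * (a - β) + β         ≈⟨ solve 2 (λ a β → con (+ 1) :* (a :- β) :+ β := a) refl a β ⟩
          a                        ∎
        Bu′+b≈u : ((B ⊙ u′) +V b) ≈V u
        Bu′+b≈u = ≈V-trans (+V-cong (≈V-trans (⊙-cong B≈s ≈V-refl) (scalar-⊙ s u′)) ≈V-refl)
                    (coordinate (x u) (x b) , coordinate (y u) (y b))

    StabOmega⇒eigenvector : ∀ {g v} → ¬ (v ≈V 0V) → StabOmega v g → Σ Carrier λ s → (proj₂ g ⊙ v) ≈V (s ·V v)
    StabOmega⇒eigenvector {b , B} {v} v≉0 (image , _) with image (0V , v) v≉0 (0V , ≈L-refl)
    ... | _ , gL≈ = direction-parallel gL≈

module MatrixPowers {c ℓ} (F : Field c ℓ) (A : Geometry.M F) where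
  open Field F
  open Geometry F
  open AffinePlane F
  open IntegerCoefficientSolver commRing
  open import Relation.Binary.Reasoning.Setoid ≈M-setoid

  ^M-+ : ∀ m n → ((A ^M m) ⊗ (A ^M n)) ≈M (A ^M (m ℕ.+ n))
  ^M-+ zero    n = ⊗-identityˡ (A ^M n)
  ^M-+ (suc m) n = ≈M-trans (⊗-assoc A (A ^M m) (A ^M n)) (⊗-cong ≈M-refl (^M-+ m n))

  ^M-cong : ∀ {m n} → m ≡ n → (A ^M m) ≈M (A ^M n)
  ^M-cong ≡.refl = ≈M-refl

  ^M-comm : ∀ k → ((A ^M k) ⊗ A) ≈M (A ⊗ (A ^M k))
  ^M-comm k = begin
    (A ^M k) ⊗ A         ≈⟨ ⊗-cong ≈M-refl (⊗-identityʳ A) ⟨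
    (A ^M k) ⊗ (A ^M 1)  ≈⟨ ^M-+ k 1 ⟩
    A ^M (k ℕ.+ 1)       ≈⟨ ^M-cong (ℕ.+-comm k 1) ⟩
    A ^M (1 ℕ.+ k)       ∎

  module FiniteOrder {n} (order : HasOrder A n) (0<n : 0 ℕ.< n) where

    ^M-*-order : ∀ k → (A ^M (k ℕ.* n)) ≈M I
    ^M-*-order zero    = ≈M-refl
    ^M-*-order (suc k) = begin
      A ^M (n ℕ.+ k ℕ.* n)         ≈⟨ ^M-+ n (k ℕ.* n) ⟨
      (A ^M n) ⊗ (A ^M (k ℕ.* n))  ≈⟨ ⊗-cong (proj₁ order) (^M-*-order k) ⟩
      I ⊗ I                        ≈⟨ ⊗-identityˡ I ⟩
      I                            ∎

    ^M-leftInverse : ∀ k → Σ M λ Q → (Q ⊗ (A ^M k)) ≈M I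
    ^M-leftInverse k = A ^M (k ℕ.* n ℕ.∸ k) , (begin
      (A ^M (k ℕ.* n ℕ.∸ k)) ⊗ (A ^M k)  ≈⟨ ^M-+ (k ℕ.* n ℕ.∸ k) k ⟩
      A ^M (k ℕ.* n ℕ.∸ k ℕ.+ k)         ≈⟨ ^M-cong (ℕ.m∸n+n≡m (ℕ.m≤m*n k n)) ⟩
      A ^M (k ℕ.* n)                     ≈⟨ ^M-*-order k ⟩
      I                                  ∎)
      where instance _ = ℕ.>-nonZero 0<n

    ^M-kernel : ∀ k {v} → ((A ^M k) ⊙ v) ≈V 0V → v ≈V 0V
    ^M-kernel k {v} Aᵏv≈0 with ^M-leftInverse k
    ... | Q , QAᵏ≈I =
      ≈V-trans (≈V-sym (⊙-identity v)) (≈V-trans (⊙-cong (≈M-sym QAᵏ≈I) ≈V-refl)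
        (≈V-trans (⊗-⊙ Q (A ^M k) v) (≈V-trans (⊙-cong ≈M-refl Aᵏv≈0) (⊙-zero Q))))

    ^M-scalar-nonzero : ∀ k {s} → (A ^M k) ≈M scalar s → ¬ (s ≈ 0#)
    ^M-scalar-nonzero k {s} Aᵏ≈s s≈0 =
      e₁≉0 (^M-kernel k (≈V-trans (⊙-cong Aᵏ≈s ≈V-refl) (≈V-trans (scalar-⊙ s e₁) (·V-zero s≈0 e₁))))

    ^M-injective : ∀ {i j} → i ℕ.< j → j ℕ.< n → (A ^M i) ≈M (A ^M j) → ⊥
    ^M-injective {i} {j} i<j j<n Aⁱ≈Aʲ with ^M-leftInverse i
    ... | Q , QAⁱ≈I = proj₂ order (j ℕ.∸ i) (ℕ.m<n⇒0<n∸m i<j) (ℕ.≤-<-trans (ℕ.m∸n≤m j i) j<n) (begin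
      A ^M (j ℕ.∸ i)                     ≈⟨ ⊗-identityˡ _ ⟨
      I ⊗ (A ^M (j ℕ.∸ i))               ≈⟨ ⊗-cong QAⁱ≈I ≈M-refl ⟨
      (Q ⊗ (A ^M i)) ⊗ (A ^M (j ℕ.∸ i))  ≈⟨ ⊗-assoc Q (A ^M i) _ ⟩
      Q ⊗ ((A ^M i) ⊗ (A ^M (j ℕ.∸ i)))  ≈⟨ ⊗-cong ≈M-refl (^M-+ i (j ℕ.∸ i)) ⟩
      Q ⊗ (A ^M (i ℕ.+ (j ℕ.∸ i)))       ≈⟨ ⊗-cong ≈M-refl (^M-cong (ℕ.m+[n∸m]≡n (ℕ.<⇒≤ i<j))) ⟩
      Q ⊗ (A ^M j)                       ≈⟨ ⊗-cong ≈M-refl Aⁱ≈Aʲ ⟨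
      Q ⊗ (A ^M i)                       ≈⟨ QAⁱ≈I ⟩
      I                                  ∎)

  aI+bA : Carrier × Carrier → M
  aI+bA (a , b) = mat (a + b * m11 A) (b * m12 A) (b * m21 A) (a + b * m22 A)

  aI+bA-cong : ∀ {a a′ b b′} → a ≈ a′ → b ≈ b′ → aI+bA (a , b) ≈M aI+bA (a′ , b′)
  aI+bA-cong a≈ b≈ = +-cong a≈ (*-congʳ b≈) , *-congʳ b≈ , *-congʳ b≈ , +-cong a≈ (*-congʳ b≈)

  -- By Cayley–Hamilton, A² = tr A · A - det A · I.
  times-A : Carrier × Carrier → Carrier × Carrier
  times-A (a , b) = - (b * (m11 A * m22 A - m12 A * m21 A)) , a + b * (m11 A + m22 A)

  A⊗aI+bA : ∀ p → (A ⊗ aI+bA p) ≈M aI+bA (times-A p)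
  A⊗aI+bA (a , b) =
    solve 6 (λ a b p r s u → p :* (a :+ b :* p) :+ r :* (b :* s) := (:- (b :* (p :* u :- r :* s))) :+ (a :+ b :* (p :+ u)) :* p) refl a b (m11 A) (m12 A) (m21 A) (m22 A) ,
    solve 6 (λ a b p r s u → p :* (b :* r) :+ r :* (a :+ b :* u) := (a :+ b :* (p :+ u)) :* r) refl a b (m11 A) (m12 A) (m21 A) (m22 A) ,
    solve 6 (λ a b p r s u → s :* (a :+ b :* p) :+ u :* (b :* s) := (a :+ b :* (p :+ u)) :* s) refl a b (m11 A) (m12 A) (m21 A) (m22 A) ,
    solve 6 (λ a b p r s u → s :* (b :* r) :+ u :* (a :+ b :* u) := (:- (b :* (p :* u :- r :* s))) :+ (a :+ b :* (p :+ u)) :* u) refl a b (m11 A) (m12 A) (m21 A) (m22 A)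

  powerCoeffs : ℕ → Carrier × Carrier
  powerCoeffs zero    = 1# , 0#
  powerCoeffs (suc n) = times-A (powerCoeffs n)

  ^M≈aI+bA : ∀ n → (A ^M n) ≈M aI+bA (powerCoeffs n)
  ^M≈aI+bA zero = sym (diagonal (m11 A)) , sym (zeroˡ (m12 A)) , sym (zeroˡ (m21 A)) , sym (diagonal (m22 A))
    where
    diagonal : ∀ a → 1# + 0# * a ≈ 1#
    diagonal a = trans (+-congˡ (zeroˡ a)) (+-identityʳ 1#)
  ^M≈aI+bA (suc n) = ≈M-trans (⊗-cong ≈M-refl (^M≈aI+bA n)) (A⊗aI+bA (powerCoeffs n))

  aI+bA-⊙-eigenvector : ∀ {v μ} → (A ⊙ v) ≈V (μ ·V v) → ∀ a b → (aI+bA (a , b) ⊙ v) ≈V ((a + b * μ) ·V v)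
  aI+bA-⊙-eigenvector {vec v₁ v₂} {μ} (Av≈₁ , Av≈₂) a b =
    trans (solve 6 (λ a b p r v₁ v₂ → (a :+ b :* p) :* v₁ :+ (b :* r) :* v₂ := a :* v₁ :+ b :* (p :* v₁ :+ r :* v₂)) refl a b (m11 A) (m12 A) v₁ v₂)
          (trans (+-congˡ (*-congˡ Av≈₁)) (solve 4 (λ a b μ v₁ → a :* v₁ :+ b :* (μ :* v₁) := (a :+ b :* μ) :* v₁) refl a b μ v₁)) ,
    trans (solve 6 (λ a b s u v₁ v₂ → (b :* s) :* v₁ :+ (a :+ b :* u) :* v₂ := a :* v₂ :+ b :* (s :* v₁ :+ u :* v₂)) refl a b (m21 A) (m22 A) v₁ v₂)
          (trans (+-congˡ (*-congˡ Av≈₂)) (solve 4 (λ a b μ v₂ → a :* v₂ :+ b :* (μ :* v₂) := (a :+ b :* μ) :* v₂) refl a b μ v₂))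

  aI+bA-of-scalar : ∀ {μ} → A ≈M scalar μ → ∀ a b → aI+bA (a , b) ≈M scalar (a + b * μ)
  aI+bA-of-scalar {μ} (A₁₁≈ , A₁₂≈ , A₂₁≈ , A₂₂≈) a b =
    +-congˡ (*-congˡ A₁₁≈) , trans (*-congˡ A₁₂≈) (zeroʳ b) ,
    trans (*-congˡ A₂₁≈) (zeroʳ b) , +-congˡ (*-congˡ A₂₂≈)

  A-μI≈0⇒A≈μI : ∀ {μ} → aI+bA (- μ , 1#) ≈M aI+bA (0# , 0#) → A ≈M scalar μ
  A-μI≈0⇒A≈μI {μ} (d₁₁ , d₁₂ , d₂₁ , d₂₂) =
    diagonal (m11 A) d₁₁ , off-diagonal (m12 A) d₁₂ , off-diagonal (m21 A) d₂₁ , diagonal (m22 A) d₂₂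
    where
    diagonal : ∀ a → - μ + 1# * a ≈ 0# + 0# * a → a ≈ μ
    diagonal a h = x-y≈0⇒x≈y (trans (solve 2 (λ μ a → a :- μ := (:- μ :+ con (+ 1) :* a) :- (con (+ 0) :+ con (+ 0) :* a)) refl μ a)
                                    (x≈y⇒x-y≈0 h))
    off-diagonal : ∀ a → 1# * a ≈ 0# * a → a ≈ 0#
    off-diagonal a h = trans (sym (*-identityˡ a)) (trans h (zeroˡ a))

module FiniteField {c ℓ} (F : Field c ℓ) {q} (F-size : HasSize F q) where
  open Field F
  open Geometry F

  private
    index : Carrier → Fin q
    index a = proj₁ (proj₂ (proj₂ F-size) a)

    index-≈ : ∀ a → proj₁ F-size (index a) ≈ a
    index-≈ a = proj₂ (proj₂ (proj₂ F-size) a)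

    ≡-index⇒≈ : ∀ {a b} → index a ≡ index b → a ≈ b
    ≡-index⇒≈ {a} {b} i≡j = trans (sym (index-≈ a)) (trans (reflexive (≡.cong (proj₁ F-size) i≡j)) (index-≈ b))

    ≈⇒≡-index : ∀ {a b} → a ≈ b → index a ≡ index b
    ≈⇒≡-index {a} {b} a≈b = proj₁ (proj₂ F-size) _ _ (trans (index-≈ a) (trans a≈b (sym (index-≈ b))))

    distinct⇒2≤ : ∀ {n} (i j : Fin n) → ¬ (i ≡ j) → 2 ℕ.≤ n
    distinct⇒2≤ {suc zero}    Fin.zero Fin.zero i≢j = ⊥-elim (i≢j ≡.refl)
    distinct⇒2≤ {suc (suc n)} _        _        _   = ℕ.s≤s (ℕ.s≤s ℕ.z≤n)

  _≟_ : Decidable _≈_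
  a ≟ b with index a Fin.≟ index b
  ... | yes i≡j = yes (≡-index⇒≈ i≡j)
  ... | no  i≢j = no (λ a≈b → i≢j (≈⇒≡-index a≈b))

  _≟M_ : Decidable _≈M_
  mat a b d e ≟M mat a′ b′ d′ e′ = a ≟ a′ ×-dec b ≟ b′ ×-dec d ≟ d′ ×-dec e ≟ e′

  2≤size : 2 ℕ.≤ q
  2≤size = distinct⇒2≤ (index 1#) (index 0#) (λ i≡j → 1≉0 (≡-index⇒≈ i≡j))

  collision : ∀ {n} → q ℕ.< n → (f : Fin n → Carrier) → ∃₂ λ i j → i Fin.< j × f i ≈ f j
  collision q<n f with FP.pigeonhole q<n (index ∘ f)
  ... | i , j , i<j , i≡j = i , j , i<j , ≡-index⇒≈ i≡j

  collision₂ : ∀ {n} → q ℕ.* q ℕ.< n → (f g : Fin n → Carrier) →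
               ∃₂ λ i j → i Fin.< j × f i ≈ f j × g i ≈ g j
  collision₂ q²<n f g with FP.pigeonhole q²<n (λ i → Fin.combine (index (f i)) (index (g i)))
  ... | i , j , i<j , c≡c with FP.combine-injective _ _ _ _ c≡c
  ...   | fi≡fj , gi≡gj = i , j , i<j , ≡-index⇒≈ fi≡fj , ≡-index⇒≈ gi≡gj

module SingerCycle {c ℓ} (F : Field c ℓ) {q} (F-size : HasSize F q)
                   (A : Geometry.M F) (singer : Geometry.Singer F q A) where
  open Field F
  open Geometry F
  open WithA A
  open AffinePlane F
  open FiniteField F F-size
  open MatrixPowers F A
  open IntegerCoefficientSolver commRing

  N : ℕ
  N = q ℕ.* q ℕ.∸ 1

  0<q : 0 ℕ.< q
  0<q = ℕ.≤-trans (ℕ.n≤1+n 1) 2≤size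

  1+N≡q² : suc N ≡ q ℕ.* q
  1+N≡q² = ≡.trans (ℕ.+-comm 1 N) (ℕ.m∸n+n≡m (ℕ.*-mono-≤ 0<q 0<q))

  q<1+N : q ℕ.< suc N
  q<1+N = ≡.subst (q ℕ.<_) (≡.sym 1+N≡q²) (ℕ.m<m*n q q 2≤size)
    where instance _ = ℕ.>-nonZero 0<q

  q²<2+N : q ℕ.* q ℕ.< suc (suc N)
  q²<2+N = ≡.subst (λ m → q ℕ.* q ℕ.< suc m) (≡.sym 1+N≡q²) (ℕ.n<1+n (q ℕ.* q))

  0<N : 0 ℕ.< N
  0<N = ℕ.≤-trans (ℕ.s≤s ℕ.z≤n) (ℕ.s≤s⁻¹ (ℕ.≤-trans 2≤size (ℕ.<⇒≤ q<1+N)))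

  open FiniteOrder singer 0<N

  private module Eigenvector {v μ} (v≉0 : ¬ (v ≈V 0V)) (Av≈μv : (A ⊙ v) ≈V (μ ·V v)) where

    not-a-power : ∀ {a b} → a + b * μ ≈ 0# → ∀ k → aI+bA (a , b) ≈M (A ^M k) → ⊥
    not-a-power {a} {b} a+bμ≈0 k X≈Aᵏ = v≉0 (^M-kernel k (≈V-trans (⊙-cong (≈M-sym X≈Aᵏ) ≈V-refl)
      (≈V-trans (aI+bA-⊙-eigenvector Av≈μv a b) (·V-zero a+bμ≈0 v))))

    candidates : Fin (suc N) → Carrier × Carrier
    candidates Fin.zero    = 0# , 0#
    candidates (Fin.suc k) = powerCoeffs (Fin.toℕ k)

    candidates-distinct : ∀ {i j} → i Fin.< j → aI+bA (candidates i) ≈M aI+bA (candidates j) → ⊥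
    candidates-distinct {Fin.zero} {Fin.suc k} _ X≈Y =
      not-a-power (trans (+-identityˡ _) (zeroˡ μ)) (Fin.toℕ k) (≈M-trans X≈Y (≈M-sym (^M≈aI+bA (Fin.toℕ k))))
    candidates-distinct {Fin.suc i} {Fin.suc k} (ℕ.s≤s i<k) X≈Y =
      ^M-injective i<k (FP.toℕ<n k) (≈M-trans (^M≈aI+bA (Fin.toℕ i)) (≈M-trans X≈Y (≈M-sym (^M≈aI+bA (Fin.toℕ k)))))

    scalar-impossible : A ≈M scalar μ → ⊥
    scalar-impossible A≈μ with collision q<1+N (λ i → proj₁ (candidates i) + proj₂ (candidates i) * μ)
    ... | i , j , i<j , λᵢ≈λⱼ = candidates-distinct i<j
      (≈M-trans (aI+bA-of-scalar A≈μ _ _) (≈M-trans (λᵢ≈λⱼ , refl , refl , λᵢ≈λⱼ) (≈M-sym (aI+bA-of-scalar A≈μ _ _))))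

    extended : Fin (suc (suc N)) → Carrier × Carrier
    extended Fin.zero    = - μ , 1#
    extended (Fin.suc i) = candidates i

    extended-distinct : ¬ (A ≈M scalar μ) → ∀ {i j} → i Fin.< j → aI+bA (extended i) ≈M aI+bA (extended j) → ⊥
    extended-distinct A≉μ {Fin.zero} {Fin.suc Fin.zero} _ X≈0 = A≉μ (A-μI≈0⇒A≈μI X≈0)
    extended-distinct _ {Fin.zero} {Fin.suc (Fin.suc k)} _ X≈Y =
      not-a-power (solve 1 (λ μ → :- μ :+ con (+ 1) :* μ := con (+ 0)) refl μ) (Fin.toℕ k)
                  (≈M-trans X≈Y (≈M-sym (^M≈aI+bA (Fin.toℕ k))))
    extended-distinct _ {Fin.suc i} {Fin.suc j} (ℕ.s≤s i<j) X≈Y = candidates-distinct i<j X≈Y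

    nonscalar-impossible : ¬ (A ≈M scalar μ) → ⊥
    nonscalar-impossible A≉μ with collision₂ q²<2+N (proj₁ ∘ extended) (proj₂ ∘ extended)
    ... | i , j , i<j , aᵢ≈aⱼ , bᵢ≈bⱼ = extended-distinct A≉μ i<j (aI+bA-cong aᵢ≈aⱼ bᵢ≈bⱼ)

  no-eigenvector : ∀ {v μ} → ¬ (v ≈V 0V) → ¬ ((A ⊙ v) ≈V (μ ·V v))
  no-eigenvector {v} {μ} v≉0 Av≈μv with A ≟M scalar μ
  ... | yes A≈μ = Eigenvector.scalar-impossible v≉0 Av≈μv A≈μ
  ... | no  A≉μ = Eigenvector.nonscalar-impossible v≉0 Av≈μv A≉μ

  power-eigenvector⇒scalar : ∀ k {v s} → ¬ (v ≈V 0V) → ((A ^M k) ⊙ v) ≈V (s ·V v) → (A ^M k) ≈M scalar s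
  power-eigenvector⇒scalar k {v} {s} v≉0 Aᵏv≈sv =
    common-eigenvectors⇒scalar (A ^M k) Aᵏv≈sv Aᵏ[Av]≈s[Av]
      (λ det≈0 → no-eigenvector v≉0 (proj₂ (det≈0⇒parallel _≟_ v≉0 det≈0)))
    where
    Aᵏ[Av]≈s[Av] : ((A ^M k) ⊙ (A ⊙ v)) ≈V (s ·V (A ⊙ v))
    Aᵏ[Av]≈s[Av] = ≈V-trans (≈V-sym (⊗-⊙ (A ^M k) A v)) (≈V-trans (⊙-cong (^M-comm k) ≈V-refl)
      (≈V-trans (⊗-⊙ A (A ^M k) v) (≈V-trans (⊙-cong ≈M-refl Aᵏv≈sv) (⊙-·V A s v))))

  stabilizer⇒dilation : ∀ {ω g} → IsLine ω → InStab ω g → IsDilation g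
  stabilizer⇒dilation {u , v} {b , B} v≉0 ((k , B≈Aᵏ) , gω≈ω) =
    dilation s (^M-scalar-nonzero k Aᵏ≈s) (≈M-trans B≈Aᵏ Aᵏ≈s)
    where
    direction : Σ Carrier λ s → (B ⊙ v) ≈V (s ·V v)
    direction = direction-parallel {(B ⊙ u) +V b} {B ⊙ v} {u} {v} gω≈ω
    s : Carrier
    s = proj₁ direction
    Aᵏ≈s : (A ^M k) ≈M scalar s
    Aᵏ≈s = power-eigenvector⇒scalar k v≉0 (≈V-trans (⊙-cong (≈M-sym B≈Aᵏ) ≈V-refl) (proj₂ direction))

  Fix⇒dilation : ∀ {g} → InFix g → IsDilation g
  Fix⇒dilation (gen ω ω-line g∈Gω) = stabilizer⇒dilation ω-line g∈Gω
  Fix⇒dilation one                  = dilation 1# 1≉0 ≈M-refl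
  Fix⇒dilation (mul g∈Fix h∈Fix)    = dilation-∘A (Fix⇒dilation g∈Fix) (Fix⇒dilation h∈Fix)
  Fix⇒dilation (inv g∈Fix _ hg≈id)  = dilation-inverse hg≈id (Fix⇒dilation g∈Fix)
  Fix⇒dilation (resp g∈Fix g≈h)     = dilation-resp g≈h (Fix⇒dilation g∈Fix)

  Mq⇒dilation : ∀ {g} → InMq g → IsDilation g
  Mq⇒dilation {b , B} ((k , B≈Aᵏ) , stabilizes) =
    dilation (m11 B) (^M-scalar-nonzero k (≈M-trans (≈M-sym B≈Aᵏ) B≈s)) B≈s
    where
    B≈s : B ≈M scalar (m11 B)
    B≈s = all-eigenvectors⇒scalar B (λ v v≉0 → StabOmega⇒eigenvector A v≉0 (stabilizes v v≉0))

lemma3p6 : ∀ {c ℓ : Level} (q : ℕ) → IsPrimePower q →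
    (F : Field c ℓ) → HasSize F q →
    (A : Geometry.M F) → Geometry.Singer F q A →
    ∀ g → Geometry.WithA.InG F A g →
      (Geometry.WithA.InFix F A g ⇔ Geometry.WithA.InMq F A g)
lemma3p6 q _ F F-size A singer g g∈G =
  mk⇔ (λ g∈Fix → g∈G , dilation⇒StabOmega A (Fix⇒dilation g∈Fix))
      (λ g∈Mq → dilation∈G⇒Fix A g∈G (Mq⇒dilation g∈Mq))
  where
  open AffinePlane F
  open SingerCycle F F-size A singer
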